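{- Let $G$ be a graph and $M\subseteq V(G)$ a connected module of $G$. Then $M$ is a module of every minimum interval supergraph of $G$.
   Context: Graphs are finite, simple, undirected. A set $M\subseteq V(G)$ is a module of $G$ if every vertex outside $M$ is adjacent either to all vertices of $M$ or to none of them; it is a connected module if moreover $G[M]$ is connected. An interval supergraph of $G$ is an interval graph $\widehat G$ with $V(\widehat G)=V(G)$ and $E(G)\subseteq E(\widehat G)$; it is minimum if it has the minimum number of edges among all interval supergraphs of $G$. -}

module Defs where

open import Data.Nat using (ℕ; zero; suc; _≤_; _+_)
open import Data.Fin using (Fin; _<_)
open import Data.Bool using (Bool; true; false; T; if_then_else_)
open import Data.List using (List; []; _∷_; sum; map; allFin; concatMap; filterᵇ; length)
open import Data.Product using (Σ; _×_; _,_; ∃)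
open import Relation.Binary.PropositionalEquality using (_≡_; _≢_)

record Graph (n : ℕ) : Set where
  field
    adj     : Fin n → Fin n → Bool
    irrefl  : ∀ v → adj v v ≡ false
    sym     : ∀ u v → adj u v ≡ adj v u
open Graph public

Adj : ∀ {n} → Graph n → Fin n → Fin n → Set
Adj G u v = T (adj G u v)

VSet : ℕ → Set₁
VSet n = Fin n → Set

edgeCount : ∀ {n} → Graph n → ℕ
edgeCount {n} G =
  length (filterᵇ (λ p → pairOK (Data.Product.proj₁ p) (Data.Product.proj₂ p))
                  (concatMap (λ i → map (λ j → (i , j)) (allFin n)) (allFin n)))
  where
  open import Data.Fin using (toℕ)
  open import Data.Bool using (_∧_)
  pairOK : Fin n → Fin n → Bool
  pairOK i j = (toℕ i Data.Nat.<ᵇ toℕ j) ∧ adj G i j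

_⊆E_ : ∀ {n} → Graph n → Graph n → Set
_⊆E_ {n} G H = ∀ (u v : Fin n) → Adj G u v → Adj H u v

-- Interval graph: there are closed intervals [l v , r v] (l v ≤ r v) such that
-- distinct vertices are adjacent iff their intervals intersect.
-- (Endpoints in ℕ: for finitely many intervals this is no loss of generality.)
IsInterval : ∀ {n} → Graph n → Set
IsInterval {n} H =
  Σ (Fin n → ℕ) λ l → Σ (Fin n → ℕ) λ r →
    (∀ v → l v ≤ r v) ×
    (∀ u v → u ≢ v → (Adj H u v → (l u ≤ r v × l v ≤ r u))
                   × ((l u ≤ r v × l v ≤ r u) → Adj H u v))

IsIntervalSupergraph : ∀ {n} → Graph n → Graph n → Set
IsIntervalSupergraph G H = IsInterval H × (G ⊆E H)

IsMinIntervalSupergraph : ∀ {n} → Graph n → Graph n → Set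
IsMinIntervalSupergraph {n} G H =
  IsIntervalSupergraph G H ×
  (∀ (H' : Graph n) → IsIntervalSupergraph G H' → edgeCount H ≤ edgeCount H')

IsModule : ∀ {n} → Graph n → VSet n → Set
IsModule {n} G M =
  ∀ (x : Fin n) → (M x → Data.Empty.⊥) →
    (∀ v → M v → Adj G x v) Data.Sum.⊎ (∀ v → M v → (Adj G x v → Data.Empty.⊥))
  where import Data.Empty; import Data.Sum

data WalkIn {n} (G : Graph n) (M : VSet n) : Fin n → Fin n → Set where
  here : ∀ {u} → M u → WalkIn G M u u
  step : ∀ {u w v} → M u → Adj G u w → WalkIn G M w v → WalkIn G M u v

IsConnectedSet : ∀ {n} → Graph n → VSet n → Set
IsConnectedSet {n} G M = (∃ λ v → M v) × (∀ u v → M u → M v → WalkIn G M u v)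

IsConnectedModule : ∀ {n} → Graph n → VSet n → Set
IsConnectedModule G M = IsModule G M × IsConnectedSet G M

module Submission where

-- Suppose some x ∉ M sees, in H, one vertex of M but not another.  Walking
-- inside G[M] between the two gives an edge m₁m₂ of G[M] with x ~ m₁ and
-- x ≁ m₂ in H.  Fix an interval model (l , r) of H and let A be the set of
-- outside vertices G-adjacent to M, hence to all of M.  Keep H on both sides of
-- M, but join M exactly to the outside vertices whose interval meets a window
-- [a , b]; scaling the model of M into the window shows this is again an
-- interval graph.  If two intervals of A are disjoint, M is a clique of H and a
-- window between them works; otherwise, by Helly, a point shared by A and some
-- vertices of M works.  Either way no vertex of M gains outside neighbours and
-- m₁ loses x, so by the handshake lemma the number of edges drops, against the
-- minimality of H.

open import Defs hiding (sym)
open import Data.Nat using (ℕ; zero; suc; _+_; _*_; _≤_; _<_; _<ᵇ_; _≤ᵇ_; _≤?_; _<?_; z≤n; s≤s)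
open import Data.Nat.Properties
open import Data.Fin using (Fin; zero; suc; toℕ)
import Data.Fin.Properties as Fin
open import Data.Bool using (Bool; true; false; T; not; _∧_; _∨_; _xor_; if_then_else_)
open import Data.Bool.Properties using (∧-zeroʳ; T-∧; T-∨)
open import Data.List using (List; _++_; length; map; filterᵇ; concatMap; allFin; tabulate)
open import Data.List.Properties using (length-++; filter-++; map-tabulate)
open import Data.List.Membership.Propositional using (_∈_)
open import Data.List.Membership.Propositional.Properties using (∈-filter⁺; ∈-allFin)
import Data.List.Relation.Unary.All as All
open import Data.List.Relation.Unary.All.Properties using (all-filter)
open import Data.List.Extrema.Nat
  using (argmin; argmax; argmin-all; argmax-all; f[argmin]≤f[xs]; f[xs]≤f[argmax])
open import Data.Product using (∃; ∃₂; _×_; _,_; proj₁; proj₂)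
open import Data.Sum using (_⊎_; inj₁; inj₂; [_,_]′)
open import Data.Empty using (⊥; ⊥-elim)
open import Function using (_∘_; _⇔_; mk⇔; Equivalence)
open import Relation.Nullary using (¬_; Dec; yes; no)
open import Relation.Nullary.Decidable
  using (T?; isYes; _×-dec_; toWitness; fromWitness; decidable-stable; ¬¬-excluded-middle)
open import Relation.Binary.Definitions using (tri<; tri≈; tri>)
open import Relation.Binary.PropositionalEquality
open import Algebra.Properties.CommutativeMonoid.Sum +-0-commutativeMonoid
  using (sum; sum-syntax; sum-cong-≗; ∑-distrib-+; ∑-comm)

𝟙 : Bool → ℕ
𝟙 true  = 1
𝟙 false = 0

≡true : ∀ {b} → T b → b ≡ true
≡true {true} _ = refl

≡false : ∀ {b} → ¬ T b → b ≡ false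
≡false {false} _ = refl
≡false {true}  ¬t = ⊥-elim (¬t _)

𝟙-mono : ∀ {a b} → (T a → T b) → 𝟙 a ≤ 𝟙 b
𝟙-mono {false}         _   = z≤n
𝟙-mono {true} {true}   _   = ≤-refl
𝟙-mono {true} {false}  a⇒b = ⊥-elim (a⇒b _)

𝟙-< : ∀ {a b} → ¬ T a → T b → 𝟙 a < 𝟙 b
𝟙-< {false} {true} _  _ = s≤s z≤n
𝟙-< {true}         ¬a _ = ⊥-elim (¬a _)

half-< : ∀ {a b} → a + a < b + b → a < b
half-< lt = ≰⇒> (λ b≤a → <⇒≱ lt (+-mono-≤ b≤a b≤a))

sum-mono-≤ : ∀ {n} {f g : Fin n → ℕ} → (∀ i → f i ≤ g i) → sum f ≤ sum g
sum-mono-≤ {zero}  f≤g = z≤n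
sum-mono-≤ {suc n} f≤g = +-mono-≤ (f≤g zero) (sum-mono-≤ (f≤g ∘ suc))

sum-mono-< : ∀ {n} {f g : Fin n → ℕ} → (∀ i → f i ≤ g i) → ∀ k → f k < g k → sum f < sum g
sum-mono-< f≤g zero    fk<gk = +-mono-<-≤ fk<gk (sum-mono-≤ (f≤g ∘ suc))
sum-mono-< f≤g (suc k) fk<gk = +-mono-≤-< (f≤g zero) (sum-mono-< (f≤g ∘ suc) k fk<gk)

count : ∀ {A : Set} → (A → Bool) → List A → ℕ
count p xs = length (filterᵇ p xs)

count-++ : ∀ {A : Set} (p : A → Bool) (xs ys : List A) →
           count p (xs ++ ys) ≡ count p xs + count p ys
count-++ p xs ys = trans (cong length (filter-++ (T? ∘ p) xs ys)) (length-++ (filterᵇ p xs))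

count-tabulate : ∀ {A : Set} (p : A → Bool) {m} (h : Fin m → A) →
                 count p (tabulate h) ≡ ∑[ i < m ] 𝟙 (p (h i))
count-tabulate p {zero}  h = refl
count-tabulate p {suc m} h with p (h zero)
... | true  = cong suc (count-tabulate p (h ∘ suc))
... | false = count-tabulate p (h ∘ suc)

count-concatMap : ∀ {A X : Set} (p : A → Bool) (g : X → List A) {m} (h : Fin m → X) →
                  count p (concatMap g (tabulate h)) ≡ ∑[ i < m ] count p (g (h i))
count-concatMap p g {zero}  h = refl
count-concatMap p g {suc m} h =
  trans (count-++ p (g (h zero)) _) (cong (count p (g (h zero)) +_) (count-concatMap p g (h ∘ suc)))

orderedAdj : ∀ {n} → Graph n → Fin n → Fin n → Bool
orderedAdj K i j = (toℕ i <ᵇ toℕ j) ∧ adj K i j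

edgeCount-as-sum : ∀ {n} (K : Graph n) →
                   edgeCount K ≡ ∑[ i < n ] ∑[ j < n ] 𝟙 (orderedAdj K i j)
edgeCount-as-sum {n} K =
  trans (count-concatMap p (λ i → map (i ,_) (allFin n)) (λ i → i))
        (sum-cong-≗ λ i → trans (cong (count p) (map-tabulate (λ j → j) (i ,_)))
                                (count-tabulate p (i ,_)))
  where
  p : Fin n × Fin n → Bool
  p (i , j) = orderedAdj K i j

-- Each edge {i , j} is seen once as an ordered pair, from its smaller end.
adj-split : ∀ {n} (K : Graph n) (i j : Fin n) →
            𝟙 (adj K i j) ≡ 𝟙 (orderedAdj K i j) + 𝟙 (orderedAdj K j i)
adj-split K i j with Fin.<-cmp i j
... | tri< i<j _ j≮i
  rewrite ≡true (<⇒<ᵇ i<j) | ≡false {toℕ j <ᵇ toℕ i} (j≮i ∘ <ᵇ⇒< _ _) = sym (+-identityʳ _)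
... | tri≈ _ refl _ rewrite irrefl K i | ∧-zeroʳ (toℕ i <ᵇ toℕ i) = refl
... | tri> i≮j _ j<i
  rewrite ≡false {toℕ i <ᵇ toℕ j} (i≮j ∘ <ᵇ⇒< _ _) | ≡true (<⇒<ᵇ j<i) | Graph.sym K j i = refl

degreeSum : ∀ {n} → Graph n → ℕ
degreeSum {n} K = ∑[ u < n ] ∑[ v < n ] 𝟙 (adj K u v)

handshake : ∀ {n} (K : Graph n) → degreeSum K ≡ edgeCount K + edgeCount K
handshake {n} K = begin
  degreeSum K
    ≡⟨ sum-cong-≗ (λ i → sum-cong-≗ (adj-split K i)) ⟩
  ∑[ i < n ] ∑[ j < n ] (E i j + E j i)
    ≡⟨ sum-cong-≗ (λ i → ∑-distrib-+ (E i) (λ j → E j i)) ⟩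
  ∑[ i < n ] (∑[ j < n ] E i j + ∑[ j < n ] E j i)
    ≡⟨ ∑-distrib-+ (λ i → ∑[ j < n ] E i j) _ ⟩
  ∑[ i < n ] ∑[ j < n ] E i j + ∑[ i < n ] ∑[ j < n ] E j i
    ≡⟨ cong (∑[ i < n ] ∑[ j < n ] E i j +_) (sym (∑-comm E)) ⟩
  ∑[ i < n ] ∑[ j < n ] E i j + ∑[ i < n ] ∑[ j < n ] E i j
    ≡⟨ cong₂ _+_ (sym (edgeCount-as-sum K)) (sym (edgeCount-as-sum K)) ⟩
  edgeCount K + edgeCount K ∎
  where
  open ≡-Reasoning
  E : Fin n → Fin n → ℕ
  E i j = 𝟙 (orderedAdj K i j)

module Crossing {n} (inM : Fin n → Bool) where

  Out : Fin n → Set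
  Out v = ¬ T (inM v)

  outside : (Fin n → Bool) → ℕ
  outside S = ∑[ v < n ] 𝟙 (not (inM v) ∧ S v)

  outDeg : Graph n → Fin n → ℕ
  outDeg K u = outside (adj K u)

  private
    term-mono : ∀ {S S' : Fin n → Bool} → (∀ v → Out v → T (S v) → T (S' v)) →
                ∀ v → 𝟙 (not (inM v) ∧ S v) ≤ 𝟙 (not (inM v) ∧ S' v)
    term-mono {S} {S'} S⊆S' v with inM v in e
    ... | true  = z≤n
    ... | false = 𝟙-mono (S⊆S' v (subst T e))

  outside-mono : ∀ {S S' : Fin n → Bool} → (∀ v → Out v → T (S v) → T (S' v)) →
                 outside S ≤ outside S'
  outside-mono {S} {S'} S⊆S' = sum-mono-≤ (term-mono {S} {S'} S⊆S')

  outside-mono-< : ∀ {S S' : Fin n → Bool} → (∀ v → Out v → T (S v) → T (S' v)) →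
                   ∀ x → Out x → ¬ T (S x) → T (S' x) → outside S < outside S'
  outside-mono-< {S} {S'} S⊆S' x x∉M x∉S x∈S' = sum-mono-< (term-mono {S} {S'} S⊆S') x strict
    where
    strict : 𝟙 (not (inM x) ∧ S x) < 𝟙 (not (inM x) ∧ S' x)
    strict rewrite ≡false x∉M = 𝟙-< x∉S x∈S'

  within leaving : Graph n → Fin n → Fin n → ℕ
  within  K u v = 𝟙 (not (inM u xor inM v) ∧ adj K u v)
  leaving K u v = 𝟙 (inM u ∧ (not (inM v) ∧ adj K u v))

  adj-decompose : ∀ K u v → 𝟙 (adj K u v) ≡ within K u v + leaving K u v + leaving K v u
  adj-decompose K u v with inM u | inM v
  ... | true  | true  = sym (trans (+-identityʳ _) (+-identityʳ _))
  ... | true  | false = sym (+-identityʳ _)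
  ... | false | true  = cong 𝟙 (Graph.sym K u v)
  ... | false | false = sym (trans (+-identityʳ _) (+-identityʳ _))

  totalWithin totalLeaving : Graph n → ℕ
  totalWithin K = ∑[ u < n ] ∑[ v < n ] within K u v
  totalLeaving K = ∑[ u < n ] ∑[ v < n ] leaving K u v

  degreeSum-decompose : ∀ K → degreeSum K ≡ totalWithin K + totalLeaving K + totalLeaving K
  degreeSum-decompose K = begin
    degreeSum K
      ≡⟨ sum-cong-≗ (λ u → sum-cong-≗ (adj-decompose K u)) ⟩
    ∑[ u < n ] ∑[ v < n ] (within K u v + leaving K u v + leaving K v u)
      ≡⟨ sum-cong-≗ (λ u → ∑-distrib-+ _ (λ v → leaving K v u)) ⟩
    ∑[ u < n ] (∑[ v < n ] (within K u v + leaving K u v) + ∑[ v < n ] leaving K v u)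
      ≡⟨ ∑-distrib-+ _ (λ u → ∑[ v < n ] leaving K v u) ⟩
    ∑[ u < n ] ∑[ v < n ] (within K u v + leaving K u v) + ∑[ u < n ] ∑[ v < n ] leaving K v u
      ≡⟨ cong₂ _+_ (trans (sum-cong-≗ (λ u → ∑-distrib-+ (within K u) (leaving K u)))
                          (∑-distrib-+ (λ u → ∑[ v < n ] within K u v) _))
                   (sym (∑-comm (leaving K))) ⟩
    totalWithin K + totalLeaving K + totalLeaving K ∎
    where open ≡-Reasoning

  totalWithin-cong : ∀ {K K'} → (∀ u v → inM u ≡ inM v → adj K' u v ≡ adj K u v) →
                     totalWithin K' ≡ totalWithin K
  totalWithin-cong {K} {K'} agree = sum-cong-≗ λ u → sum-cong-≗ λ v → term u v
    where
    term : ∀ u v → within K' u v ≡ within K u v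
    term u v with inM u in eu | inM v in ev
    ... | true  | true  = cong 𝟙 (agree u v (trans eu (sym ev)))
    ... | true  | false = refl
    ... | false | true  = refl
    ... | false | false = cong 𝟙 (agree u v (trans eu (sym ev)))

  -- Row u of the leaving pairs is the out-degree of u if u ∈ M, and empty otherwise.
  leaving-row-mono : ∀ {K K'} → (∀ u → T (inM u) → outDeg K' u ≤ outDeg K u) →
               ∀ u → ∑[ v < n ] leaving K' u v ≤ ∑[ v < n ] leaving K u v
  leaving-row-mono {K} {K'} le u with inM u in eu
  ... | true  = le u (subst T (sym eu) _)
  ... | false = ≤-refl

  leaving-row-mono-< : ∀ {K K'} u → T (inM u) → outDeg K' u < outDeg K u →
                 ∑[ v < n ] leaving K' u v < ∑[ v < n ] leaving K u v
  leaving-row-mono-< u u∈M lt rewrite ≡true u∈M = lt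

  edgeCount-decrease : ∀ {K K'} →
    (∀ u v → inM u ≡ inM v → adj K' u v ≡ adj K u v) →
    (∀ u → T (inM u) → outDeg K' u ≤ outDeg K u) →
    ∀ u₀ → T (inM u₀) → outDeg K' u₀ < outDeg K u₀ →
    edgeCount K' < edgeCount K
  edgeCount-decrease {K} {K'} agree le u₀ u₀∈M lt = half-< (begin-strict
    edgeCount K' + edgeCount K'
      ≡⟨ sym (handshake K') ⟩
    degreeSum K'
      ≡⟨ degreeSum-decompose K' ⟩
    totalWithin K' + totalLeaving K' + totalLeaving K'
      <⟨ +-mono-≤-< (+-mono-≤ (≤-reflexive (totalWithin-cong {K} {K'} agree)) (<⇒≤ fewer-leaving))
                    fewer-leaving ⟩
    totalWithin K + totalLeaving K + totalLeaving K
      ≡⟨ sym (degreeSum-decompose K) ⟩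
    degreeSum K
      ≡⟨ handshake K ⟩
    edgeCount K + edgeCount K ∎)
    where
    open ≤-Reasoning
    fewer-leaving : totalLeaving K' < totalLeaving K
    fewer-leaving =
      sum-mono-< (leaving-row-mono {K} {K'} le) u₀ (leaving-row-mono-< {K} {K'} u₀ u₀∈M lt)

module Extremal {n} (P : Fin n → Bool) (f : Fin n → ℕ) where

  private
    members : List (Fin n)
    members = filterᵇ P (allFin n)

    member : ∀ {u} → T (P u) → u ∈ members
    member {u} u∈P = ∈-filter⁺ (T? ∘ P) (∈-allFin u) u∈P

  minimiser : ∀ w → T (P w) → ∃ λ m → T (P m) × (∀ u → T (P u) → f m ≤ f u)
  minimiser w w∈P =
    argmin f w members ,
    argmin-all f w∈P (all-filter (T? ∘ P) (allFin n)) ,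
    λ u u∈P → All.lookup (f[argmin]≤f[xs] w members) (member u∈P)

  maximiser : ∀ w → T (P w) → ∃ λ m → T (P m) × (∀ u → T (P u) → f u ≤ f m)
  maximiser w w∈P =
    argmax f w members ,
    argmax-all f w∈P (all-filter (T? ∘ P) (allFin n)) ,
    λ u u∈P → All.lookup (f[xs]≤f[argmax] w members) (member u∈P)

Meets : ∀ {n} → (Fin n → ℕ) → (Fin n → ℕ) → Fin n → Fin n → Set
Meets l r u v = l u ≤ r v × l v ≤ r u

Models : ∀ {n} → Graph n → (Fin n → ℕ) → (Fin n → ℕ) → Set
Models {n} K l r = ∀ (u v : Fin n) → u ≢ v → Adj K u v ⇔ Meets l r u v

interval-from-model : ∀ {n} {K : Graph n} (l r : Fin n → ℕ) →
                      (∀ v → l v ≤ r v) → Models K l r → IsInterval K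
interval-from-model l r l≤r model =
  l , r , l≤r , λ u v u≢v → Equivalence.to (model u v u≢v) , Equivalence.from (model u v u≢v)

model-of-interval : ∀ {n} {K : Graph n} {l r : Fin n → ℕ} →
  (∀ u v → u ≢ v → (Adj K u v → Meets l r u v) × (Meets l r u v → Adj K u v)) → Models K l r
model-of-interval iv u v u≢v = mk⇔ (proj₁ (iv u v u≢v)) (proj₂ (iv u v u≢v))

-- Both sides of a model are symmetric, so it suffices to check one orientation.
model-flip : ∀ {n} {K : Graph n} {l r : Fin n → ℕ} {u v} →
             Adj K v u ⇔ Meets l r v u → Adj K u v ⇔ Meets l r u v
model-flip {K = K} {u = u} {v} vu =
  mk⇔ (λ a → swap (Equivalence.to vu (subst T (Graph.sym K u v) a)))
      (λ m → subst T (Graph.sym K v u) (Equivalence.from vu (swap m)))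
  where
  swap : ∀ {A B : Set} → A × B → B × A
  swap (a , b) = b , a

scaled-≤ : ∀ {B x y p q} → p ≤ q → q ≤ B → x ≤ y ⇔ suc B * x + p ≤ suc B * y + q
scaled-≤ {B} {x} {y} {p} {q} p≤q q≤B =
  mk⇔ (λ x≤y → +-mono-≤ (*-monoʳ-≤ (suc B) x≤y) p≤q)
      (λ le → ≮⇒≥ (λ y<x → <⇒≱ (overshoot y<x) le))
  where
  open ≤-Reasoning
  overshoot : y < x → suc B * y + q < suc B * x + p
  overshoot y<x = begin-strict
    suc B * y + q       ≤⟨ +-monoʳ-≤ (suc B * y) q≤B ⟩
    suc B * y + B       <⟨ +-monoʳ-< (suc B * y) (n<1+n B) ⟩
    suc B * y + suc B   ≡⟨ trans (+-comm (suc B * y) (suc B)) (sym (*-suc (suc B) y)) ⟩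
    suc B * suc y       ≤⟨ *-monoʳ-≤ (suc B) y<x ⟩
    suc B * x           ≤⟨ m≤m+n (suc B * x) p ⟩
    suc B * x + p       ∎

module Reattach {n} (inM : Fin n → Bool) (H : Graph n) (S : Fin n → Bool) where
  open Crossing inM

  adjR : Fin n → Fin n → Bool
  adjR u v = if inM u then (if inM v then adj H u v else S v)
                      else (if inM v then S u else adj H u v)

  reattach : Graph n
  reattach = record { adj = adjR ; irrefl = adjR-irrefl ; sym = adjR-sym }
    where
    adjR-irrefl : ∀ v → adjR v v ≡ false
    adjR-irrefl v with inM v
    ... | true  = irrefl H v
    ... | false = irrefl H v
    adjR-sym : ∀ u v → adjR u v ≡ adjR v u
    adjR-sym u v with inM u | inM v
    ... | true  | true  = Graph.sym H u v
    ... | true  | false = refl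
    ... | false | true  = refl
    ... | false | false = Graph.sym H u v

  reattach-agree : ∀ u v → inM u ≡ inM v → adj reattach u v ≡ adj H u v
  reattach-agree u v same with inM u | inM v
  ... | true  | true  = refl
  ... | false | false = refl
  reattach-agree u v () | true  | false
  reattach-agree u v () | false | true

  reattach-outDeg : ∀ u → T (inM u) → outDeg reattach u ≡ outside S
  reattach-outDeg u u∈M rewrite ≡true u∈M = sum-cong-≗ term
    where
    term : ∀ v → 𝟙 (not (inM v) ∧ (if inM v then adj H u v else S v)) ≡
                 𝟙 (not (inM v) ∧ S v)
    term v with inM v
    ... | true  = refl
    ... | false = refl

module Window {n} (inM : Fin n → Bool) (H : Graph n) (l r : Fin n → ℕ)
                  (l≤r : ∀ v → l v ≤ r v) (model : Models H l r) where

  window : ℕ → ℕ → Fin n → Bool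
  window a b v = (l v ≤ᵇ b) ∧ (a ≤ᵇ r v)

  Clique : Set
  Clique = ∀ u v → T (inM u) → T (inM v) → u ≢ v → Adj H u v

  window⇔ : ∀ {a b v} → T (window a b v) ⇔ (l v ≤ b × a ≤ r v)
  window⇔ {a} {b} {v} = mk⇔
    (λ w → let (x , y) = Equivalence.to T-∧ w in ≤ᵇ⇒≤ (l v) b x , ≤ᵇ⇒≤ a (r v) y)
    (λ (x , y) → Equivalence.from T-∧ (≤⇒≤ᵇ x , ≤⇒≤ᵇ y))

  -- Squeezing a scaled copy of the model of H[M] into a window [a , b] of a
  -- scaled copy of the whole model shows that joining M to exactly the outside
  -- vertices meeting [a , b] keeps the graph an interval graph.  Inside M the
  -- copy is only faithful if the window is a point, or if M is a clique of H.
  window-interval : ∀ B → (∀ v → r v ≤ B) → ∀ {a b} → a ≤ b → a ≡ b ⊎ Clique →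
    IsInterval (Reattach.reattach inM H (window a b))
  window-interval B r≤B {a} {b} a≤b shape = interval-from-model {K = reattach} l' r' l'≤r' model'
    where
    open Reattach inM H (window a b)
    K = suc B

    l≤B : ∀ v → l v ≤ B
    l≤B v = ≤-trans (l≤r v) (r≤B v)

    l' r' : Fin n → ℕ
    l' v = if inM v then K * a + l v else K * l v + 0
    r' v = if inM v then K * b + r v else K * r v + B

    l'≤r' : ∀ v → l' v ≤ r' v
    l'≤r' v with inM v
    ... | true  = +-mono-≤ (*-monoʳ-≤ K a≤b) (l≤r v)
    ... | false = Equivalence.to (scaled-≤ z≤n ≤-refl) (l≤r v)

    both-in : ∀ u v → u ≢ v → inM u ≡ true → inM v ≡ true →
             Adj reattach u v ⇔ Meets l' r' u v
    both-in u v u≢v eu ev rewrite eu | ev = mk⇔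
      (λ uv → let (x , y) = Equivalence.to (model u v u≢v) uv in
              +-mono-≤ (*-monoʳ-≤ K a≤b) x , +-mono-≤ (*-monoʳ-≤ K a≤b) y)
      (λ (x , y) → [ (λ a≡b → Equivalence.from (model u v u≢v) (cancel a≡b x , cancel a≡b y))
                   , (λ clique → clique u v (subst T (sym eu) _) (subst T (sym ev) _) u≢v)
                   ]′ shape)
      where
      cancel : ∀ {p q} → a ≡ b → K * a + p ≤ K * b + q → p ≤ q
      cancel {p} {q} a≡b le =
        +-cancelˡ-≤ (K * a) p q (subst (λ c → K * a + p ≤ K * c + q) (sym a≡b) le)

    crossing : ∀ u v → inM u ≡ true → inM v ≡ false → Adj reattach u v ⇔ Meets l' r' u v
    crossing u v eu ev rewrite eu | ev = mk⇔
      (λ w → let (lv≤b , a≤rv) = Equivalence.to window⇔ w in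
             Equivalence.to (scaled-≤ (l≤B u) ≤-refl) a≤rv ,
             Equivalence.to (scaled-≤ z≤n (r≤B u)) lv≤b)
      (λ (x , y) → Equivalence.from window⇔
             (Equivalence.from (scaled-≤ z≤n (r≤B u)) y ,
              Equivalence.from (scaled-≤ (l≤B u) ≤-refl) x))

    both-out : ∀ u v → u ≢ v → inM u ≡ false → inM v ≡ false →
               Adj reattach u v ⇔ Meets l' r' u v
    both-out u v u≢v eu ev rewrite eu | ev = mk⇔
      (λ uv → let (x , y) = Equivalence.to (model u v u≢v) uv in
              Equivalence.to scale x , Equivalence.to scale y)
      (λ (x , y) → Equivalence.from (model u v u≢v) (Equivalence.from scale x , Equivalence.from scale y))
      where
      scale : ∀ {x y} → x ≤ y ⇔ K * x + 0 ≤ K * y + B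
      scale = scaled-≤ z≤n ≤-refl

    model' : Models reattach l' r'
    model' u v u≢v = by-sides (inM u) (inM v) refl refl
      where
      by-sides : ∀ s t → inM u ≡ s → inM v ≡ t → Adj reattach u v ⇔ Meets l' r' u v
      by-sides true  true  eu ev = both-in u v u≢v eu ev
      by-sides true  false eu ev = crossing u v eu ev
      by-sides false true  eu ev = model-flip {K = reattach} (crossing v u ev eu)
      by-sides false false eu ev = both-out u v u≢v eu ev

-- One-dimensional Helly property: pairwise intersecting intervals share a
-- point, namely the largest left endpoint.
helly : ∀ {n} (P : Fin n → Bool) (l r : Fin n → ℕ) →
        (∀ u v → T (P u) → T (P v) → l u ≤ r v) →
        ∀ w → T (P w) → ∃ λ t → ∀ v → T (P v) → l v ≤ t × t ≤ r v
helly P l r pairwise w w∈P with Extremal.maximiser P l w w∈P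
... | m , m∈P , l≤lm = l m , λ v v∈P → l≤lm v v∈P , pairwise m v m∈P v∈P

module Core {n} (G H : Graph n) (inM : Fin n → Bool) (modG : IsModule G (T ∘ inM))
  (l r : Fin n → ℕ) (l≤r : ∀ v → l v ≤ r v) (model : Models H l r)
  (G⊆H : G ⊆E H) (minimal : ∀ H' → IsIntervalSupergraph G H' → edgeCount H ≤ edgeCount H')
  {x m₁ m₂ : Fin n} (x∉M : ¬ T (inM x)) (m₁∈M : T (inM m₁)) (m₂∈M : T (inM m₂))
  (m₁m₂ : Adj G m₁ m₂) (xm₁ : Adj H x m₁) (¬xm₂ : ¬ Adj H x m₂) where

  open Crossing inM using (Out; outside; outDeg; outside-mono; outside-mono-<; edgeCount-decrease)
  open Window inM H l r l≤r model

  M≢Out : ∀ {u v} → T (inM u) → Out v → u ≢ v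
  M≢Out u∈M v∉M refl = v∉M u∈M

  -- The outside vertices with a G-neighbour in M; as M is a module of G they
  -- are G-adjacent, hence H-adjacent, to all of M.
  A : Fin n → Bool
  A z = not (inM z) ∧ adj G z m₁

  A-out : ∀ {z} → T (A z) → Out z
  A-out {z} z∈A z∈M = subst (λ b → T (not b ∧ adj G z m₁)) (≡true z∈M) z∈A

  A-meets : ∀ {z m} → T (A z) → T (inM m) → Meets l r z m
  A-meets {z} {m} z∈A m∈M with modG z (A-out z∈A)
  ... | inj₁ all  = Equivalence.to (model z m (M≢Out m∈M (A-out z∈A) ∘ sym)) (G⊆H z m (all m m∈M))
  ... | inj₂ none = ⊥-elim (none m₁ m₁∈M (proj₂ (Equivalence.to T-∧ z∈A)))

  into-A : ∀ {u v} → T (inM u) → Out v → Adj G u v → T (A v)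
  into-A {u} {v} u∈M v∉M uv with modG v v∉M
  ... | inj₁ all  = Equivalence.from T-∧ (subst (T ∘ not) (sym (≡false v∉M)) _ , all m₁ m₁∈M)
  ... | inj₂ none = ⊥-elim (none u u∈M (subst T (Graph.sym G u v) uv))

  no-improvement : ∀ S → IsInterval (Reattach.reattach inM H S) → (∀ z → T (A z) → T (S z)) →
    (∀ u → T (inM u) → outside S ≤ outDeg H u) → outside S < outDeg H m₁ → ⊥
  no-improvement S S-interval A⊆S ≤all <m₁ =
    <⇒≱ fewer (minimal reattach (S-interval , G⊆reattach))
    where
    open Reattach inM H S
    G⊆reattach : G ⊆E reattach
    G⊆reattach u v uv with inM u in eu | inM v in ev
    ... | true  | true  = G⊆H u v uv
    ... | false | false = G⊆H u v uv
    ... | true  | false = A⊆S v (into-A (subst T (sym eu) _) (subst T ev) uv)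
    ... | false | true  =
      A⊆S u (into-A (subst T (sym ev) _) (subst T eu) (subst T (Graph.sym G u v) uv))
    fewer : edgeCount reattach < edgeCount H
    fewer = edgeCount-decrease {K = H} {K' = reattach} reattach-agree
      (λ u u∈M → subst (_≤ outDeg H u) (sym (reattach-outDeg u u∈M)) (≤all u u∈M))
      m₁ m₁∈M (subst (_< outDeg H m₁) (sym (reattach-outDeg m₁ m₁∈M)) <m₁)

  Inside : ℕ → ℕ → Fin n → Set
  Inside a b w = l w ≤ a × b ≤ r w

  window⊆N : ∀ {a b w} → T (inM w) → Inside a b w → ∀ v → Out v → T (window a b v) → Adj H w v
  window⊆N w∈M (lw≤a , b≤rw) v v∉M v∈W with Equivalence.to window⇔ v∈W
  ... | lv≤b , a≤rv =
    Equivalence.from (model _ v (M≢Out w∈M v∉M)) (≤-trans lw≤a a≤rv , ≤-trans lv≤b b≤rw)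

  window-≤ : ∀ {a b w} → T (inM w) → Inside a b w → outside (window a b) ≤ outDeg H w
  window-≤ w∈M w⊇ab = outside-mono (window⊆N w∈M w⊇ab)

  -- x is a neighbour of m₁ missing every window inside the interval of m₂.
  window-< : ∀ {a b} → Inside a b m₁ → Inside a b m₂ → outside (window a b) < outDeg H m₁
  window-< {a} {b} m₁⊇ab (lm₂≤a , b≤rm₂) =
    outside-mono-< (window⊆N m₁∈M m₁⊇ab) x x∉M x∉W (subst T (Graph.sym H x m₁) xm₁)
    where
    x∉W : ¬ T (window a b x)
    x∉W x∈W with Equivalence.to window⇔ x∈W
    ... | lx≤b , a≤rx = ¬xm₂ (Equivalence.from (model x m₂ (M≢Out m₂∈M x∉M ∘ sym))
                                (≤-trans lx≤b b≤rm₂ , ≤-trans lm₂≤a a≤rx))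

  -- A bound for all right endpoints, needed to scale the model.
  B : ℕ
  B = r (proj₁ (Extremal.maximiser (λ _ → true) r m₁ _))

  r≤B : ∀ v → r v ≤ B
  r≤B v = proj₂ (proj₂ (Extremal.maximiser (λ _ → true) r m₁ _)) v _

  A-Meets : ℕ → ℕ → Set
  A-Meets a b = ∀ z → T (A z) → l z ≤ b × a ≤ r z

  no-good-window : ∀ {a b} → a ≤ b → a ≡ b ⊎ Clique → A-Meets a b →
    (∀ u → T (inM u) → outside (window a b) ≤ outDeg H u) → outside (window a b) < outDeg H m₁ → ⊥
  no-good-window {a} {b} a≤b shape A-meets-window =
    no-improvement (window a b) (window-interval B r≤B a≤b shape)
                   (λ z z∈A → Equivalence.from window⇔ (A-meets-window z z∈A))

  -- First case: two intervals of A are disjoint, r y < l z.  Then the window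
  -- from the largest left endpoint in M to the largest one in A lies inside
  -- every interval of M, so M is a clique of H and the window is a candidate.
  spread-case : ∀ {y z} → T (A y) → T (A z) → r y < l z → ⊥
  spread-case {y} {z} y∈A z∈A ry<lz
    with Extremal.maximiser inM l m₁ m₁∈M | Extremal.maximiser A l y y∈A
  ... | mL , mL∈M , l≤lmL | zL , zL∈A , l≤lzL =
    no-good-window a≤b (inj₂ clique) (λ w w∈A → l≤lzL w w∈A , proj₂ (A-meets w∈A mL∈M))
      (λ u u∈M → window-≤ u∈M (M-inside u∈M)) (window-< (M-inside m₁∈M) (M-inside m₂∈M))
    where
    M-inside : ∀ {m} → T (inM m) → Inside (l mL) (l zL) m
    M-inside {m} m∈M = l≤lmL m m∈M , proj₁ (A-meets zL∈A m∈M)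
    a≤b : l mL ≤ l zL
    a≤b = ≤-trans (proj₂ (A-meets y∈A mL∈M)) (≤-trans (<⇒≤ ry<lz) (l≤lzL z z∈A))
    clique : Clique
    clique u v u∈M v∈M u≢v = Equivalence.from (model u v u≢v) (lu≤rv u∈M v∈M , lu≤rv v∈M u∈M)
      where
      lu≤rv : ∀ {u v} → T (inM u) → T (inM v) → l u ≤ r v
      lu≤rv u∈M v∈M = ≤-trans (proj₁ (M-inside u∈M)) (≤-trans a≤b (proj₂ (M-inside v∈M)))

  -- Second case: the intervals of A pairwise intersect.  Then, by Helly, the
  -- intervals of A together with those of two meeting vertices w₁ , w₂ of M
  -- share a point.
  module Cluster (intersecting : ∀ y z → T (A y) → T (A z) → l z ≤ r y)
                 {w₁ w₂} (w₁∈M : T (inM w₁)) (w₂∈M : T (inM w₂)) (w₁w₂ : Meets l r w₁ w₂) where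

    W P : Fin n → Bool
    W v = isYes (v Fin.≟ w₁) ∨ isYes (v Fin.≟ w₂)
    P v = A v ∨ W v

    member : ∀ {v} → T (P v) → T (A v) ⊎ (v ≡ w₁ ⊎ v ≡ w₂)
    member {v} v∈P with Equivalence.to (T-∨ {A v} {W v}) v∈P
    ... | inj₁ v∈A = inj₁ v∈A
    ... | inj₂ v∈W with Equivalence.to (T-∨ {isYes (v Fin.≟ w₁)} {isYes (v Fin.≟ w₂)}) v∈W
    ...   | inj₁ v≡w₁ = inj₂ (inj₁ (toWitness {a? = v Fin.≟ w₁} v≡w₁))
    ...   | inj₂ v≡w₂ = inj₂ (inj₂ (toWitness {a? = v Fin.≟ w₂} v≡w₂))

    A⊆P : ∀ {z} → T (A z) → T (P z)
    A⊆P {z} z∈A = Equivalence.from (T-∨ {A z} {W z}) (inj₁ z∈A)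

    W⊆P : ∀ {w} → T (W w) → T (P w)
    W⊆P {w} w∈W = Equivalence.from (T-∨ {A w} {W w}) (inj₂ w∈W)

    w₁∈P : T (P w₁)
    w₁∈P = W⊆P (Equivalence.from (T-∨ {isYes (w₁ Fin.≟ w₁)} {isYes (w₁ Fin.≟ w₂)})
                                 (inj₁ (fromWitness {a? = w₁ Fin.≟ w₁} refl)))

    w₂∈P : T (P w₂)
    w₂∈P = W⊆P (Equivalence.from (T-∨ {isYes (w₂ Fin.≟ w₁)} {isYes (w₂ Fin.≟ w₂)})
                                 (inj₂ (fromWitness {a? = w₂ Fin.≟ w₂} refl)))

    pairwise : ∀ u v → T (P u) → T (P v) → l u ≤ r v
    pairwise u v u∈P v∈P with member u∈P | member v∈P
    ... | inj₁ u∈A         | inj₁ v∈A         = intersecting v u v∈A u∈A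
    ... | inj₁ u∈A         | inj₂ (inj₁ refl) = proj₁ (A-meets u∈A w₁∈M)
    ... | inj₁ u∈A         | inj₂ (inj₂ refl) = proj₁ (A-meets u∈A w₂∈M)
    ... | inj₂ (inj₁ refl) | inj₁ v∈A         = proj₂ (A-meets v∈A w₁∈M)
    ... | inj₂ (inj₂ refl) | inj₁ v∈A         = proj₂ (A-meets v∈A w₂∈M)
    ... | inj₂ (inj₁ refl) | inj₂ (inj₁ refl) = l≤r u
    ... | inj₂ (inj₁ refl) | inj₂ (inj₂ refl) = proj₁ w₁w₂
    ... | inj₂ (inj₂ refl) | inj₂ (inj₁ refl) = proj₂ w₁w₂
    ... | inj₂ (inj₂ refl) | inj₂ (inj₂ refl) = l≤r u

    common-point : ∃ λ t → A-Meets t t × Inside t t w₁ × Inside t t w₂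
    common-point with helly P l r pairwise w₁ w₁∈P
    ... | t , in-all = t , (λ z z∈A → in-all z (A⊆P z∈A)) , in-all w₁ w₁∈P , in-all w₂ w₂∈P

  m₁≢m₂ : m₁ ≢ m₂
  m₁≢m₂ refl = ¬xm₂ xm₁

  point-fails : ∀ {t} → A-Meets t t →
    (∀ u → T (inM u) → outside (window t t) ≤ outDeg H u) → outside (window t t) < outDeg H m₁ → ⊥
  point-fails = no-good-window ≤-refl (inj₁ refl)

  -- In the second case a point window works: take a vertex ms of M of least
  -- out-degree, and the common point of A with m₁ , m₂, or else with ms alone.
  intersecting-case : (∀ y z → T (A y) → T (A z) → l z ≤ r y) → ⊥
  intersecting-case intersecting
    with Extremal.minimiser inM (outDeg H) m₁ m₁∈M
       | Cluster.common-point intersecting m₁∈M m₂∈M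
           (Equivalence.to (model m₁ m₂ m₁≢m₂) (G⊆H m₁ m₂ m₁m₂))
  ... | ms , ms∈M , ms-least | t , A-at-t , m₁∋t , m₂∋t
    with outside (window t t) ≤? outDeg H ms
  ...   | yes ≤ms = point-fails A-at-t (λ u u∈M → ≤-trans ≤ms (ms-least u u∈M)) (window-< m₁∋t m₂∋t)
  ...   | no  ≰ms with Cluster.common-point intersecting ms∈M ms∈M (l≤r ms , l≤r ms)
  ...     | s , A-at-s , ms∋s , _ =
    point-fails A-at-s (λ u u∈M → ≤-trans (window-≤ ms∈M ms∋s) (ms-least u u∈M))
      (begin-strict
        outside (window s s)  ≤⟨ window-≤ ms∈M ms∋s ⟩
        outDeg H ms           <⟨ ≰⇒> ≰ms ⟩
        outside (window t t)  <⟨ window-< m₁∋t m₂∋t ⟩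
        outDeg H m₁           ∎)
    where open ≤-Reasoning

  contradiction : ⊥
  contradiction
    with Fin.any? (λ y → Fin.any? (λ z → (T? (A y) ×-dec T? (A z)) ×-dec (r y <? l z)))
  ... | yes (y , z , (y∈A , z∈A) , ry<lz) = spread-case y∈A z∈A ry<lz
  ... | no no-gap =
    intersecting-case (λ y z y∈A z∈A → ≮⇒≥ (λ lt → no-gap (y , z , (y∈A , z∈A) , lt)))

walk-exit : ∀ {n} {G : Graph n} {M : VSet n} (p : Fin n → Bool) {a b} →
  WalkIn G M a b → T (p a) → ¬ T (p b) →
  ∃₂ λ u v → M u × M v × Adj G u v × T (p u) × ¬ T (p v)
walk-exit p (here _) pa ¬pb = ⊥-elim (¬pb pa)
walk-exit p (step {w = w} a∈M aw walk) pa ¬pb with p w in e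
... | true  = walk-exit p walk (subst T (sym e) _) ¬pb
... | false = _ , w , a∈M , start walk , aw , pa , subst T e
  where
  start : ∀ {n} {G : Graph n} {M : VSet n} {u v} → WalkIn G M u v → M u
  start (here u∈M)     = u∈M
  start (step u∈M _ _) = u∈M

¬¬-decidable : ∀ {n} (P : Fin n → Set) → ¬ ¬ (∀ v → Dec (P v))
¬¬-decidable {zero}  P k = k (λ ())
¬¬-decidable {suc n} P k =
  ¬¬-excluded-middle λ P0? → ¬¬-decidable (P ∘ suc) λ P? → k λ { zero → P0? ; (suc v) → P? v }

IsModule-cong : ∀ {n} {G : Graph n} {M M' : VSet n} →
                (∀ v → M v ⇔ M' v) → IsModule G M → IsModule G M'
IsModule-cong M⇔M' modG x x∉M' with modG x (x∉M' ∘ Equivalence.to (M⇔M' x))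
... | inj₁ all  = inj₁ λ v v∈M' → all v (Equivalence.from (M⇔M' v) v∈M')
... | inj₂ none = inj₂ λ v v∈M' → none v (Equivalence.from (M⇔M' v) v∈M')

module-if-unsplit : ∀ {n} {H : Graph n} {M : VSet n} {v₀} → M v₀ →
  (∀ x → ¬ M x → ∀ a b → M a → M b → Adj H x a → ¬ Adj H x b → ⊥) → IsModule H M
module-if-unsplit {H = H} {v₀ = v₀} v₀∈M unsplit x x∉M with adj H x v₀ in e
... | true  = inj₁ λ v v∈M →
  decidable-stable (T? (adj H x v)) (unsplit x x∉M v₀ v v₀∈M v∈M (subst T (sym e) _))
... | false = inj₂ λ v v∈M xv → unsplit x x∉M v v₀ v∈M v₀∈M xv (subst T e)

theorem3 : (n : ℕ) (G : Graph n) (M : VSet n) → IsConnectedModule G M →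
    (H : Graph n) → IsMinIntervalSupergraph G H → IsModule H M
theorem3 n G M (modG , (v₀ , v₀∈M) , walks) H (((l , r , l≤r , iv) , G⊆H) , minimal) =
  module-if-unsplit {H = H} v₀∈M unsplit
  where
  split-edge-impossible : (∀ v → Dec (M v)) → ∀ {x m₁ m₂} → ¬ M x → M m₁ → M m₂ →
    Adj G m₁ m₂ → Adj H x m₁ → ¬ Adj H x m₂ → ⊥
  split-edge-impossible M? {x} {m₁} {m₂} x∉M m₁∈M m₂∈M =
    Core.contradiction G H inM (IsModule-cong {G = G} M⇔inM modG)
      l r l≤r (model-of-interval {K = H} iv)
      G⊆H minimal {x} {m₁} {m₂} (x∉M ∘ Equivalence.from (M⇔inM x))
      (Equivalence.to (M⇔inM m₁) m₁∈M) (Equivalence.to (M⇔inM m₂) m₂∈M)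
    where
    inM : Fin n → Bool
    inM v = isYes (M? v)
    M⇔inM : ∀ v → M v ⇔ T (inM v)
    M⇔inM v = mk⇔ (fromWitness {a? = M? v}) (toWitness {a? = M? v})

  unsplit : ∀ x → ¬ M x → ∀ a b → M a → M b → Adj H x a → ¬ Adj H x b → ⊥
  unsplit x x∉M a b a∈M b∈M xa ¬xb with walk-exit (adj H x) (walks a b a∈M b∈M) xa ¬xb
  ... | m₁ , m₂ , m₁∈M , m₂∈M , m₁m₂ , xm₁ , ¬xm₂ =
    ¬¬-decidable M λ M? → split-edge-impossible M? x∉M m₁∈M m₂∈M m₁m₂ xm₁ ¬xm₂
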